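{- Let $M$ be a simple matroid on a finite ground set $E$ with closure operator $\operatorname{cl}$ and set of circuits $\mathcal{C}$. Suppose that for every $C \in \mathcal{C}$ either $\operatorname{cl}(C) = C$, or there exists $f \in \operatorname{cl}(C)$ such that $C \cup \{f\}$ is a double circuit of degree $3$. Then $\{ C \in \mathcal{C} \mid \operatorname{cl}(C) = C\}$ is the unique minimal tropical basis of $M$.
   Context: Let $r$ be the rank function of $M$. A set $D \subseteq E$ is a double circuit if for every $e \in D$, $r(D) = |D|-2 = r(D\setminus\{e\})$. Every double circuit $D$ has a unique partition $D = D_1 \cup \cdots \cup D_k$ such that the circuits of $M$ contained in $D$ are exactly the sets $D \setminus D_i$, $1 \le i \le k$; the number $k$ is the degree of $D$. A subset $\mathcal{C}' \subseteq \mathcal{C}$ is a tropical basis of $M$ if for every $X \subseteq E$ with $X \neq \operatorname{cl}(X)$ there exists $C \in \mathcal{C}'$ with $|C \setminus X| = 1$. A tropical basis $\mathcal{C}'$ is minimal if for every $C \in \mathcal{C}'$ the family $\mathcal{C}' \setminus \{C\}$ is not a tropical basis. -}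

module Defs where

open import Data.Nat using (ℕ; _≤_; _<_; _+_; _≟_)
open import Data.Bool using (Bool)
open import Data.Fin using (Fin)
open import Data.Fin.Subset using (Subset; _⊆_; _⊂_; _∪_; _∩_; _─_; _-_; ⁅_⁆; ∣_∣; _∈_; ⊥)
open import Data.Vec using (tabulate)
open import Data.Product using (Σ; ∃; _×_; ∃-syntax)
open import Relation.Nullary using (¬_; ⌊_⌋)
open import Relation.Binary.PropositionalEquality using (_≡_; _≢_)
open import Function.Bundles using (_⇔_)

-- A matroid on the ground set E = Fin n, given by its rank function
-- (axioms R1–R3; nonnegativity is automatic in ℕ).
record Matroid (n : ℕ) : Set where
  field
    r        : Subset n → ℕ
    r-bound  : ∀ X → r X ≤ ∣ X ∣
    r-mono   : ∀ X Y → X ⊆ Y → r X ≤ r Y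
    r-submod : ∀ X Y → r (X ∪ Y) + r (X ∩ Y) ≤ r X + r Y

module _ {n : ℕ} (M : Matroid n) where
  open Matroid M

  Independent : Subset n → Set
  Independent X = r X ≡ ∣ X ∣

  IsCircuit : Subset n → Set
  IsCircuit C = (r C < ∣ C ∣) × (∀ D → D ⊂ C → Independent D)

  cl : Subset n → Subset n
  cl X = tabulate (λ e → ⌊ r (X ∪ ⁅ e ⁆) ≟ r X ⌋)

  -- simple: no loops and no parallel pairs, i.e. all sets of size ≤ 2 independent
  Simple : Set
  Simple = ∀ X → ∣ X ∣ ≤ 2 → Independent X

  IsDoubleCircuit : Subset n → Set
  IsDoubleCircuit D = (r D + 2 ≡ ∣ D ∣) × (∀ e → e ∈ D → r (D - e) ≡ r D)

  -- D is a double circuit of degree k: the (unique) partition D = D₁ ∪ … ∪ D_k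
  -- into nonempty blocks, such that the circuits contained in D are exactly
  -- the sets D \ Dᵢ, has k blocks.
  DegreePartition : (k : ℕ) → Subset n → (Fin k → Subset n) → Set
  DegreePartition k D P =
      (∀ i → ∃[ e ] (e ∈ P i))
    × (∀ i j → i ≢ j → P i ∩ P j ≡ ⊥)
    × (∀ e → (e ∈ D ⇔ (∃[ i ] (e ∈ P i))))
    × (∀ C → C ⊆ D → (IsCircuit C ⇔ (∃[ i ] (C ≡ D ─ P i))))

  IsDoubleCircuitOfDegree : ℕ → Subset n → Set
  IsDoubleCircuitOfDegree k D =
    IsDoubleCircuit D × ∃[ P ] DegreePartition k D P

  Family : Set₁
  Family = Subset n → Set

  IsTropicalBasis : Family → Set
  IsTropicalBasis 𝒞′ =
      (∀ C → 𝒞′ C → IsCircuit C)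
    × (∀ X → X ≢ cl X → ∃[ C ] (𝒞′ C × ∣ C ─ X ∣ ≡ 1))

  remove : Family → Subset n → Family
  remove 𝒞′ C D = 𝒞′ D × D ≢ C

  IsMinimalTropicalBasis : Family → Set
  IsMinimalTropicalBasis 𝒞′ =
    IsTropicalBasis 𝒞′ × (∀ C → 𝒞′ C → ¬ IsTropicalBasis (remove 𝒞′ C))

  closedCircuits : Family
  closedCircuits C = IsCircuit C × cl C ≡ C

  IsUniqueMinimalTropicalBasis : Family → Set₁
  IsUniqueMinimalTropicalBasis 𝒮 =
    IsMinimalTropicalBasis 𝒮
    × (∀ 𝒞′ → IsMinimalTropicalBasis 𝒞′ → ∀ C → (𝒞′ C ⇔ 𝒮 C))

{-# OPTIONS --safe #-}
-- A closed circuit C lies in every tropical basis T: for e ∈ C the set C − e is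
-- not closed, so T has a circuit C′ with exactly one element outside C − e; then
-- C′ ⊆ cl (C − e) ⊆ cl C = C, and C′ = C because circuits form an antichain.
-- Conversely, if X is not closed and e ∈ cl X − X, the fundamental circuit C of e
-- has C − X = {e}. If C is not closed, the degree-3 double circuit C ∪ {f} has
-- blocks P₀ = {f}, P₁, P₂ with C = (C ∪ {f}) − P₀; the circuits (C ∪ {f}) − Pᵢ
-- (i = 1, 2) are smaller than C since simplicity forces |Pᵢ| ≥ 2, and one of them
-- again has exactly one element outside X. Induction on |C| ends at a closed
-- circuit, so the closed circuits form a tropical basis contained in every other
-- one, which makes them the unique minimal one.
module Submission where

open import Defs
import Data.Nat as ℕ
open import Data.Nat using (ℕ; suc; _+_; _≤_; _<_; _<?_; z≤n; s≤s)
open import Data.Nat.Properties hiding (_≟_)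
open import Data.Nat.Induction using (<-wellFounded)
open import Data.Bool using (true; false)
import Data.Bool as Bool
open import Data.Bool.Properties using (T-≡)
open import Data.Fin using (Fin; zero; suc; _≟_)
open import Data.Fin.Properties using (all?; any?)
open import Data.Fin.Subset
open import Data.Fin.Subset.Properties
open import Data.Vec using ([]; _∷_; here; there)
open import Data.Vec.Properties using (≡-dec; lookup∘tabulate; []=⇒lookup; lookup⇒[]=)
open import Data.Product using (∃-syntax; _×_; _,_; proj₁; proj₂)
open import Data.Sum using (_⊎_; inj₁; inj₂; [_,_])
open import Function.Base using (_on_; _∘_; id)
open import Function.Bundles using (mk⇔; Equivalence)
open import Induction.WellFounded using (WellFounded; Acc; acc)
import Relation.Binary.Construct.On as On
open import Relation.Nullary using (¬_; Dec; yes; no; contradiction)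
open import Relation.Nullary.Decidable
  using (_×-dec_; _⊎-dec_; _→-dec_; ¬?; from-yes; map′; toWitness; fromWitness; decidable-stable)
open import Relation.Binary.PropositionalEquality hiding ([_])

private
  variable
    n : ℕ
    x : Fin n
    p q s : Subset n

x∈p─q⁻ : ∀ (p q : Subset n) → x ∈ p ─ q → x ∈ p × x ∉ q
x∈p─q⁻            (true  ∷ p) (false ∷ q) here = here , λ ()
x∈p─q⁻ {x = zero} (_     ∷ p) (true  ∷ q) ()
x∈p─q⁻ {x = zero} (false ∷ p) (false ∷ q) ()
x∈p─q⁻            (_     ∷ p) (_     ∷ q) (there x∈p─q) =
  let x∈p , x∉q = x∈p─q⁻ p q x∈p─q in there x∈p , x∉q ∘ drop-there

x∉p-x : x ∉ p - x
x∉p-x {x = x} {p = p} x∈p-x = proj₂ (x∈p─q⁻ p ⁅ x ⁆ x∈p-x) (x∈⁅x⁆ x)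

x∈p⇒⁅x⁆⊆p : x ∈ p → ⁅ x ⁆ ⊆ p
x∈p⇒⁅x⁆⊆p {x = x} x∈p y∈⁅x⁆ = subst (_∈ _) (sym (x∈⁅y⁆⇒x≡y x y∈⁅x⁆)) x∈p

x∈p∧p⊆⁅x⁆⇒p≡⁅x⁆ : x ∈ p → p ⊆ ⁅ x ⁆ → p ≡ ⁅ x ⁆
x∈p∧p⊆⁅x⁆⇒p≡⁅x⁆ x∈p p⊆⁅x⁆ = ⊆-antisym p⊆⁅x⁆ (x∈p⇒⁅x⁆⊆p x∈p)

∪-lub : p ⊆ s → q ⊆ s → p ∪ q ⊆ s
∪-lub {p = p} {q = q} p⊆s q⊆s x∈p∪q = [ p⊆s , q⊆s ] (x∈p∪q⁻ p q x∈p∪q)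

p⊆p-x∪⁅x⁆ : ∀ (p : Subset n) x → p ⊆ (p - x) ∪ ⁅ x ⁆
p⊆p-x∪⁅x⁆ p x {y} y∈p with y ≟ x
... | yes refl = q⊆p∪q (p - x) ⁅ x ⁆ (x∈⁅x⁆ x)
... | no  y≢x  = p⊆p∪q ⁅ x ⁆ (x∈p∧x≢y⇒x∈p-y y∈p y≢x)

p⊆q⇒p-x⊆q-x : p ⊆ q → p - x ⊆ q - x
p⊆q⇒p-x⊆q-x {p = p} {x = x} p⊆q y∈p-x =
  let y∈p , y∉⁅x⁆ = x∈p─q⁻ p ⁅ x ⁆ y∈p-x in x∈p∧x∉q⇒x∈p─q (p⊆q y∈p) y∉⁅x⁆

p⊆q∪s⇒p─q⊆s : p ⊆ q ∪ s → p ─ q ⊆ s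
p⊆q∪s⇒p─q⊆s {p = p} {q = q} {s = s} p⊆q∪s y∈p─q =
  let y∈p , y∉q = x∈p─q⁻ p q y∈p─q
  in [ (λ y∈q → contradiction y∈q y∉q) , id ] (x∈p∪q⁻ q s (p⊆q∪s y∈p))

p⊆q∪⁅x⁆∧x∉p⇒p⊆q : p ⊆ q ∪ ⁅ x ⁆ → x ∉ p → p ⊆ q
p⊆q∪⁅x⁆∧x∉p⇒p⊆q {q = q} {x = x} p⊆q∪⁅x⁆ x∉p y∈p =
  [ id , (λ y∈⁅x⁆ → contradiction (subst (_∈ _) (x∈⁅y⁆⇒x≡y x y∈⁅x⁆) y∈p) x∉p) ]
    (x∈p∪q⁻ q ⁅ x ⁆ (p⊆q∪⁅x⁆ y∈p))

p─q≡⁅x⁆⇒p-x⊆q : p ─ q ≡ ⁅ x ⁆ → p - x ⊆ q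
p─q≡⁅x⁆⇒p-x⊆q {p = p} {q = q} {x = x} p─q≡⁅x⁆ {y} y∈p-x =
  let y∈p , y∉⁅x⁆ = x∈p─q⁻ p ⁅ x ⁆ y∈p-x
  in decidable-stable (y ∈? q) (λ y∉q → y∉⁅x⁆ (subst (y ∈_) p─q≡⁅x⁆ (x∈p∧x∉q⇒x∈p─q y∈p y∉q)))

⊆⊎∃∉ : ∀ (p q : Subset n) → p ⊆ q ⊎ ∃[ x ] (x ∈ p × x ∉ q)
⊆⊎∃∉ p q with any? (λ x → x ∈? p ×-dec ¬? (x ∈? q))
... | yes x∈p─q = inj₂ x∈p─q
... | no  ∄x    = inj₁ λ {x} x∈p → decidable-stable (x ∈? q) (λ x∉q → ∄x (x , x∈p , x∉q))

∣p─q∣+∣q∣≡∣p∣ : ∀ (p q : Subset n) → q ⊆ p → ∣ p ─ q ∣ + ∣ q ∣ ≡ ∣ p ∣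
∣p─q∣+∣q∣≡∣p∣ []          []          _   = refl
∣p─q∣+∣q∣≡∣p∣ (true  ∷ p) (true  ∷ q) q⊆p =
  trans (+-suc _ _) (cong suc (∣p─q∣+∣q∣≡∣p∣ p q (drop-∷-⊆ q⊆p)))
∣p─q∣+∣q∣≡∣p∣ (true  ∷ p) (false ∷ q) q⊆p = cong suc (∣p─q∣+∣q∣≡∣p∣ p q (drop-∷-⊆ q⊆p))
∣p─q∣+∣q∣≡∣p∣ (false ∷ p) (false ∷ q) q⊆p = ∣p─q∣+∣q∣≡∣p∣ p q (drop-∷-⊆ q⊆p)
∣p─q∣+∣q∣≡∣p∣ (false ∷ p) (true  ∷ q) q⊆p with q⊆p here
... | ()

x∈p⇒suc∣p-x∣≡∣p∣ : x ∈ p → suc ∣ p - x ∣ ≡ ∣ p ∣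
x∈p⇒suc∣p-x∣≡∣p∣ {x = x} {p = p} x∈p = begin
  suc ∣ p - x ∣          ≡⟨ +-comm 1 _ ⟩
  ∣ p - x ∣ + 1          ≡⟨ cong (∣ p - x ∣ +_) (sym (∣⁅x⁆∣≡1 x)) ⟩
  ∣ p - x ∣ + ∣ ⁅ x ⁆ ∣  ≡⟨ ∣p─q∣+∣q∣≡∣p∣ p ⁅ x ⁆ (x∈p⇒⁅x⁆⊆p x∈p) ⟩
  ∣ p ∣                  ∎
  where open ≡-Reasoning

∣p∪q∣≤∣p∣+∣q∣ : ∀ (p q : Subset n) → ∣ p ∪ q ∣ ≤ ∣ p ∣ + ∣ q ∣
∣p∪q∣≤∣p∣+∣q∣ []          []          = z≤n
∣p∪q∣≤∣p∣+∣q∣ (true  ∷ p) (true  ∷ q) =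
  s≤s (≤-trans (∣p∪q∣≤∣p∣+∣q∣ p q) (≤-trans (n≤1+n _) (≤-reflexive (sym (+-suc _ _)))))
∣p∪q∣≤∣p∣+∣q∣ (true  ∷ p) (false ∷ q) = s≤s (∣p∪q∣≤∣p∣+∣q∣ p q)
∣p∪q∣≤∣p∣+∣q∣ (false ∷ p) (true  ∷ q) = ≤-trans (s≤s (∣p∪q∣≤∣p∣+∣q∣ p q)) (≤-reflexive (sym (+-suc _ _)))
∣p∪q∣≤∣p∣+∣q∣ (false ∷ p) (false ∷ q) = ∣p∪q∣≤∣p∣+∣q∣ p q

∣p∣≡0⇒p≡⊥ : ∀ (p : Subset n) → ∣ p ∣ ≡ 0 → p ≡ ⊥
∣p∣≡0⇒p≡⊥ []          _     = refl
∣p∣≡0⇒p≡⊥ (true  ∷ p) ()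
∣p∣≡0⇒p≡⊥ (false ∷ p) ∣p∣≡0 = cong (false ∷_) (∣p∣≡0⇒p≡⊥ p ∣p∣≡0)

∣p∣≡1⇒p≡⁅x⁆ : ∀ (p : Subset n) → ∣ p ∣ ≡ 1 → ∃[ x ] p ≡ ⁅ x ⁆
∣p∣≡1⇒p≡⁅x⁆ (true  ∷ p) ∣p∣≡1 = zero , cong (true ∷_) (∣p∣≡0⇒p≡⊥ p (suc-injective ∣p∣≡1))
∣p∣≡1⇒p≡⁅x⁆ (false ∷ p) ∣p∣≡1 =
  let x , p≡⁅x⁆ = ∣p∣≡1⇒p≡⁅x⁆ p ∣p∣≡1 in suc x , cong (false ∷_) p≡⁅x⁆

0<∣p∣⇒Nonempty : ∀ (p : Subset n) → 0 < ∣ p ∣ → Nonempty p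
0<∣p∣⇒Nonempty {n} p 0<∣p∣ with nonempty? p
... | yes p≢∅ = p≢∅
... | no  p≡∅ = contradiction (trans (cong ∣_∣ (Empty-unique p≡∅)) (∣⊥∣≡0 n)) (≢-sym (<⇒≢ 0<∣p∣))

∣∣-<-wellFounded : WellFounded {A = Subset n} (_<_ on ∣_∣)
∣∣-<-wellFounded = On.wellFounded ∣_∣ <-wellFounded

⊆-minimal : {P : Subset n → Set} → (∀ W → Dec (P W)) → P p →
            ∃[ W ] (W ⊆ p × P W × (∀ z → z ∈ W → ¬ P (W - z)))
⊆-minimal {P = P} P? = go (∣∣-<-wellFounded _)
  where
  go : ∀ {Z} → Acc (_<_ on ∣_∣) Z → P Z → ∃[ W ] (W ⊆ Z × P W × (∀ z → z ∈ W → ¬ P (W - z)))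
  go {Z} (acc smaller) PZ with any? (λ z → z ∈? Z ×-dec P? (Z - z))
  ... | no  ∄z = Z , ⊆-refl , PZ , λ z z∈Z PZ-z → ∄z (z , z∈Z , PZ-z)
  ... | yes (z , z∈Z , PZ-z) =
    let W , W⊆Z-z , PW , W-minimal = go (smaller (x∈p⇒∣p-x∣<∣p∣ z∈Z)) PZ-z
    in W , ⊆-trans W⊆Z-z (p─q⊆p Z ⁅ z ⁆) , PW , W-minimal

module _ (M : Matroid n) where
  open Matroid M

  Dependent : Subset n → Set
  Dependent X = r X < ∣ X ∣

  ∈cl⁻ : ∀ {X} → x ∈ cl M X → r (X ∪ ⁅ x ⁆) ≡ r X
  ∈cl⁻ {x = x} {X} x∈clX = toWitness {a? = r (X ∪ ⁅ x ⁆) ℕ.≟ r X}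
    (Equivalence.from T-≡ (trans (sym (lookup∘tabulate _ x)) ([]=⇒lookup x∈clX)))

  ∈cl⁺ : ∀ {X} → r (X ∪ ⁅ x ⁆) ≡ r X → x ∈ cl M X
  ∈cl⁺ {x = x} {X} r≡ =
    lookup⇒[]= x (cl M X) (trans (lookup∘tabulate _ x)
      (Equivalence.to T-≡ (fromWitness {a? = r (X ∪ ⁅ x ⁆) ℕ.≟ r X} r≡)))

  p⊆cl : ∀ X → X ⊆ cl M X
  p⊆cl X x∈X = ∈cl⁺ (≤-antisym (r-mono _ _ (∪-lub ⊆-refl (x∈p⇒⁅x⁆⊆p x∈X))) (r-mono _ _ (p⊆p∪q _)))

  cl-mono : ∀ {A B} → A ⊆ B → cl M A ⊆ cl M B
  cl-mono {A} {B} A⊆B {g} g∈clA = ∈cl⁺ (≤-antisym r[B+g]≤r[B] (r-mono _ _ (p⊆p∪q _)))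
    where
    A+g : Subset n
    A+g = A ∪ ⁅ g ⁆
    B+g⊆A+g∪B : B ∪ ⁅ g ⁆ ⊆ A+g ∪ B
    B+g⊆A+g∪B = ∪-lub (q⊆p∪q A+g B) (⊆-trans (q⊆p∪q A ⁅ g ⁆) (p⊆p∪q B))
    A⊆A+g∩B : A ⊆ A+g ∩ B
    A⊆A+g∩B a∈A = x∈p∩q⁺ (p⊆p∪q ⁅ g ⁆ a∈A , A⊆B a∈A)
    r[B+g]≤r[B] : r (B ∪ ⁅ g ⁆) ≤ r B
    r[B+g]≤r[B] = +-cancelʳ-≤ (r A) _ _ (begin
      r (B ∪ ⁅ g ⁆) + r A        ≤⟨ +-mono-≤ (r-mono _ _ B+g⊆A+g∪B) (r-mono _ _ A⊆A+g∩B) ⟩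
      r (A+g ∪ B) + r (A+g ∩ B)  ≤⟨ r-submod A+g B ⟩
      r A+g + r B                ≡⟨ cong (_+ r B) (∈cl⁻ g∈clA) ⟩
      r A + r B                  ≡⟨ +-comm (r A) (r B) ⟩
      r B + r A                  ∎)
      where open ≤-Reasoning

  cl-absorb : ∀ {Y z} → z ∈ cl M Y → cl M (Y ∪ ⁅ z ⁆) ⊆ cl M Y
  cl-absorb {Y} {z} z∈clY {x} x∈cl[Y+z] = ∈cl⁺ (≤-antisym (begin
      r (Y ∪ ⁅ x ⁆)             ≤⟨ r-mono _ _ (∪-lub (⊆-trans (p⊆p∪q ⁅ z ⁆) (p⊆p∪q ⁅ x ⁆)) (q⊆p∪q _ _)) ⟩
      r ((Y ∪ ⁅ z ⁆) ∪ ⁅ x ⁆)   ≡⟨ ∈cl⁻ x∈cl[Y+z] ⟩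
      r (Y ∪ ⁅ z ⁆)             ≡⟨ ∈cl⁻ z∈clY ⟩
      r Y                       ∎) (r-mono _ _ (p⊆p∪q ⁅ x ⁆)))
    where open ≤-Reasoning

  ∈cl[p-x]⇒cl⊆cl[p-x] : ∀ {Z z} → z ∈ cl M (Z - z) → cl M Z ⊆ cl M (Z - z)
  ∈cl[p-x]⇒cl⊆cl[p-x] {Z} {z} z∈cl[Z-z] = ⊆-trans (cl-mono (p⊆p-x∪⁅x⁆ Z z)) (cl-absorb z∈cl[Z-z])

  ≢cl⇒∃∈cl∖ : ∀ {X} → X ≢ cl M X → ∃[ e ] (e ∈ cl M X × e ∉ X)
  ≢cl⇒∃∈cl∖ {X} X≢clX with ⊆⊎∃∉ (cl M X) X
  ... | inj₁ clX⊆X = contradiction (⊆-antisym (p⊆cl X) clX⊆X) X≢clX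
  ... | inj₂ e∈clX∖X = e∈clX∖X

  independent-⊆ : ∀ {X Y} → Y ⊆ X → Independent M X → Independent M Y
  independent-⊆ {X} {Y} Y⊆X indX = ≤-antisym (r-bound Y) (+-cancelʳ-≤ ∣ X ─ Y ∣ _ _ (begin
      ∣ Y ∣ + ∣ X ─ Y ∣                  ≡⟨ trans (+-comm ∣ Y ∣ _) (∣p─q∣+∣q∣≡∣p∣ X Y Y⊆X) ⟩
      ∣ X ∣                              ≡⟨ sym indX ⟩
      r X                                ≤⟨ r-mono _ _ X⊆Y∪[X─Y] ⟩
      r (Y ∪ (X ─ Y))                    ≤⟨ m≤m+n _ _ ⟩
      r (Y ∪ (X ─ Y)) + r (Y ∩ (X ─ Y))  ≤⟨ r-submod Y (X ─ Y) ⟩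
      r Y + r (X ─ Y)                    ≤⟨ +-monoʳ-≤ (r Y) (r-bound (X ─ Y)) ⟩
      r Y + ∣ X ─ Y ∣                    ∎))
    where
    open ≤-Reasoning
    X⊆Y∪[X─Y] : X ⊆ Y ∪ (X ─ Y)
    X⊆Y∪[X─Y] {x} x∈X with x ∈? Y
    ... | yes x∈Y = p⊆p∪q _ x∈Y
    ... | no  x∉Y = q⊆p∪q Y _ (x∈p∧x∉q⇒x∈p─q x∈X x∉Y)

  circuit⁺ : ∀ {C} → Dependent C → (∀ z → z ∈ C → ¬ Dependent (C - z)) → IsCircuit M C
  circuit⁺ {C} C-dependent C-minimal = C-dependent , λ D (D⊆C , z , z∈C , z∉D) →
    independent-⊆ (λ x∈D → x∈p∧x≢y⇒x∈p-y (D⊆C x∈D) λ { refl → z∉D x∈D })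
                  (≤-antisym (r-bound _) (≮⇒≥ (C-minimal z z∈C)))

  circuit-nonempty : ∀ {C} → IsCircuit M C → Nonempty C
  circuit-nonempty {C} (C-dependent , _) = 0<∣p∣⇒Nonempty C (≤-<-trans z≤n C-dependent)

  circuit-antichain : ∀ {C D} → IsCircuit M C → IsCircuit M D → D ⊆ C → D ≡ C
  circuit-antichain {C} {D} (_ , C-minimal) (D-dependent , _) D⊆C with ⊆⊎∃∉ C D
  ... | inj₁ C⊆D = ⊆-antisym D⊆C C⊆D
  ... | inj₂ (x , x∈C , x∉D) = contradiction (C-minimal D (D⊆C , x , x∈C , x∉D)) (<⇒≢ D-dependent)

  circuit-r[p-x]≡r : ∀ {C z} → IsCircuit M C → z ∈ C → r (C - z) ≡ r C
  circuit-r[p-x]≡r {C} {z} (C-dependent , C-minimal) z∈C = ≤-antisym (r-mono _ _ (p─q⊆p C ⁅ z ⁆)) (begin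
      r C         ≤⟨ ≤-pred (≤-trans C-dependent (≤-reflexive (sym (x∈p⇒suc∣p-x∣≡∣p∣ z∈C)))) ⟩
      ∣ C - z ∣   ≡⟨ sym (C-minimal (C - z) (x∈p⇒p-x⊂p z∈C)) ⟩
      r (C - z)   ∎)
    where open ≤-Reasoning

  circuit⇒∈cl : ∀ {C z} → IsCircuit M C → z ∈ C → z ∈ cl M (C - z)
  circuit⇒∈cl {C} {z} C-circuit z∈C =
    ∈cl⁺ (trans (cong r C-z+z≡C) (sym (circuit-r[p-x]≡r C-circuit z∈C)))
    where
    C-z+z≡C : (C - z) ∪ ⁅ z ⁆ ≡ C
    C-z+z≡C = ⊆-antisym (∪-lub (p─q⊆p C ⁅ z ⁆) (x∈p⇒⁅x⁆⊆p z∈C)) (p⊆p-x∪⁅x⁆ C z)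

  simple⇒3≤∣circuit∣ : Simple M → ∀ {C} → IsCircuit M C → 3 ≤ ∣ C ∣
  simple⇒3≤∣circuit∣ simple {C} (C-dependent , _) =
    ≮⇒≥ (λ ∣C∣<3 → <⇒≢ C-dependent (simple C (≤-pred ∣C∣<3)))

  dependent-∪⁅x⁆ : ∀ {Z e} → e ∈ cl M Z → e ∉ Z → Dependent (Z ∪ ⁅ e ⁆)
  dependent-∪⁅x⁆ {Z} {e} e∈clZ e∉Z = begin-strict
      r (Z ∪ ⁅ e ⁆)  ≡⟨ ∈cl⁻ e∈clZ ⟩
      r Z            ≤⟨ r-bound Z ⟩
      ∣ Z ∣          <⟨ p⊂q⇒∣p∣<∣q∣ (p⊆p∪q ⁅ e ⁆ , e , q⊆p∪q Z ⁅ e ⁆ (x∈⁅x⁆ e) , e∉Z) ⟩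
      ∣ Z ∪ ⁅ e ⁆ ∣  ∎
    where open ≤-Reasoning

  minimal-spanning⇒∈circuit : ∀ {Z C e} → e ∈ cl M Z → (∀ z → z ∈ Z → e ∉ cl M (Z - z)) →
                              C ⊆ Z ∪ ⁅ e ⁆ → IsCircuit M C → e ∈ C
  minimal-spanning⇒∈circuit {Z} {C} {e} e∈clZ Z-minimal C⊆Z+e C-circuit =
    decidable-stable (e ∈? C) λ e∉C →
      let z , z∈C = circuit-nonempty C-circuit
          C⊆Z = p⊆q∪⁅x⁆∧x∉p⇒p⊆q C⊆Z+e e∉C
          z∈cl[Z-z] = cl-mono (p⊆q⇒p-x⊆q-x C⊆Z) (circuit⇒∈cl C-circuit z∈C)
      in Z-minimal z (C⊆Z z∈C) (∈cl[p-x]⇒cl⊆cl[p-x] z∈cl[Z-z] e∈clZ)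

  fundamental-circuit : ∀ {X e} → e ∈ cl M X → e ∉ X → ∃[ C ] (IsCircuit M C × C ─ X ≡ ⁅ e ⁆)
  fundamental-circuit {X} {e} e∈clX e∉X =
    let Z , Z⊆X , e∈clZ , Z-minimal = ⊆-minimal (λ W → e ∈? cl M W) e∈clX
        C , C⊆Z+e , C-dependent , C-minimal =
          ⊆-minimal (λ W → r W <? ∣ W ∣) (dependent-∪⁅x⁆ e∈clZ (e∉X ∘ Z⊆X))
        C-circuit = circuit⁺ C-dependent C-minimal
        e∈C = minimal-spanning⇒∈circuit e∈clZ Z-minimal C⊆Z+e C-circuit
        C─X⊆⁅e⁆ = p⊆q∪s⇒p─q⊆s (⊆-trans C⊆Z+e (∪-lub (⊆-trans Z⊆X (p⊆p∪q ⁅ e ⁆)) (q⊆p∪q X ⁅ e ⁆)))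
    in C , C-circuit , x∈p∧p⊆⁅x⁆⇒p≡⁅x⁆ (x∈p∧x∉q⇒x∈p─q e∈C e∉X) C─X⊆⁅e⁆

  one-outside⇒⊆cl : ∀ {C X g} → IsCircuit M C → C ─ X ≡ ⁅ g ⁆ → C ⊆ cl M X
  one-outside⇒⊆cl {C} {X} {g} C-circuit C─X≡⁅g⁆ {x} x∈C with x ≟ g
  ... | yes refl = cl-mono (p─q≡⁅x⁆⇒p-x⊆q C─X≡⁅g⁆) (circuit⇒∈cl C-circuit x∈C)
  ... | no  x≢g  = p⊆cl X (p─q≡⁅x⁆⇒p-x⊆q C─X≡⁅g⁆ (x∈p∧x≢y⇒x∈p-y x∈C x≢g))

  closed-circuit∈tropical-basis : ∀ {T C} → IsTropicalBasis M T → closedCircuits M C → T C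
  closed-circuit∈tropical-basis {T} {C} (T-circuits , T-tropical) (C-circuit , clC≡C) =
    let e , e∈C = circuit-nonempty C-circuit
        C-e≢cl[C-e] : C - e ≢ cl M (C - e)
        C-e≢cl[C-e] C-e≡cl = x∉p-x (subst (e ∈_) (sym C-e≡cl) (circuit⇒∈cl C-circuit e∈C))
        C′ , TC′ , ∣C′─[C-e]∣≡1 = T-tropical (C - e) C-e≢cl[C-e]
        g , C′─[C-e]≡⁅g⁆ = ∣p∣≡1⇒p≡⁅x⁆ _ ∣C′─[C-e]∣≡1
        C′⊆C = ⊆-trans (one-outside⇒⊆cl (T-circuits C′ TC′) C′─[C-e]≡⁅g⁆)
                       (⊆-trans (cl-mono (p─q⊆p C ⁅ e ⁆)) (⊆-reflexive clC≡C))
    in subst T (circuit-antichain C-circuit (T-circuits C′ TC′) C′⊆C) TC′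

  tropical-basis-⊇ : ∀ {S T} → IsTropicalBasis M S → (∀ C → S C → T C) → (∀ C → T C → IsCircuit M C) →
                     IsTropicalBasis M T
  tropical-basis-⊇ (_ , S-tropical) S⊆T T-circuits = T-circuits , λ X X≢clX →
    let C , SC , ∣C─X∣≡1 = S-tropical X X≢clX in C , S⊆T C SC , ∣C─X∣≡1

  -- S must be decidable on circuits, as T C → S C is argued by contradiction.
  least⇒unique-minimal-tropical-basis : ∀ {S} → IsTropicalBasis M S →
    (∀ {T C} → IsTropicalBasis M T → S C → T C) → (∀ C → IsCircuit M C → Dec (S C)) →
    IsUniqueMinimalTropicalBasis M S
  least⇒unique-minimal-tropical-basis {S} S-tropical S-least S? =
    (S-tropical , λ C SC S-C-tropical → proj₂ (S-least S-C-tropical SC) refl) ,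
    λ T ((T-circuits , T-tropical) , T-minimal) C → mk⇔
      (λ TC → decidable-stable (S? C (T-circuits C TC)) λ ¬SC →
        T-minimal C TC (tropical-basis-⊇ S-tropical
          (λ D SD → S-least (T-circuits , T-tropical) SD , λ { refl → ¬SC SD })
          (λ D → T-circuits D ∘ proj₁)))
      (S-least (T-circuits , T-tropical))

fin3-third : ∀ (i j : Fin 3) → i ≢ j → ∃[ k ] (k ≢ i × k ≢ j × ∀ l → l ≡ i ⊎ l ≡ j ⊎ l ≡ k)
fin3-third = from-yes (all? λ (i : Fin 3) → all? λ (j : Fin 3) → ¬? (i ≟ j) →-dec any? λ k →
  ¬? (k ≟ i) ×-dec ¬? (k ≟ j) ×-dec all? λ l → (l ≟ i) ⊎-dec (l ≟ j) ⊎-dec (l ≟ k))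

module DegreeThree (M : Matroid n) (simple : Simple M) {C : Subset n} {f : Fin n} {P : Fin 3 → Subset n}
  (C-circuit : IsCircuit M C) (partition : DegreePartition M 3 (C ∪ ⁅ f ⁆) P) where

  D : Subset n
  D = C ∪ ⁅ f ⁆

  ∈P⇒∈D : ∀ i → x ∈ P i → x ∈ D
  ∈P⇒∈D i x∈Pi = Equivalence.from (proj₁ (proj₂ (proj₂ partition)) _) (i , x∈Pi)

  ∈D⇒∈P : x ∈ D → ∃[ i ] x ∈ P i
  ∈D⇒∈P x∈D = Equivalence.to (proj₁ (proj₂ (proj₂ partition)) _) x∈D

  ∈P⇒∉P : ∀ {i j} → i ≢ j → x ∈ P i → x ∉ P j
  ∈P⇒∉P {x = x} {i} {j} i≢j x∈Pi x∈Pj =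
    ∉⊥ (subst (x ∈_) (proj₁ (proj₂ partition) i j i≢j) (x∈p∩q⁺ (x∈Pi , x∈Pj)))

  D─P-circuit : ∀ i → IsCircuit M (D ─ P i)
  D─P-circuit i = Equivalence.from (proj₂ (proj₂ (proj₂ partition)) _ (p─q⊆p D (P i))) (i , refl)

  C-index : ∃[ i ] C ≡ D ─ P i
  C-index = Equivalence.to (proj₂ (proj₂ (proj₂ partition)) C (p⊆p∪q ⁅ f ⁆)) C-circuit

  i₀ : Fin 3
  i₀ = proj₁ C-index

  ∈C⇒∉P₀ : x ∈ C → x ∉ P i₀
  ∈C⇒∉P₀ x∈C = proj₂ (x∈p─q⁻ D (P i₀) (subst (_ ∈_) (proj₂ C-index) x∈C))

  P₀⊆⁅f⁆ : P i₀ ⊆ ⁅ f ⁆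
  P₀⊆⁅f⁆ x∈P₀ = [ (λ x∈C → contradiction x∈P₀ (∈C⇒∉P₀ x∈C)) , id ] (x∈p∪q⁻ C ⁅ f ⁆ (∈P⇒∈D i₀ x∈P₀))

  f∈P₀ : f ∈ P i₀
  f∈P₀ = let x , x∈P₀ = proj₁ partition i₀ in subst (_∈ P i₀) (x∈⁅y⁆⇒x≡y f (P₀⊆⁅f⁆ x∈P₀)) x∈P₀

  D─P⊆P₀∪P : ∀ {i k} → (∀ l → l ≡ i₀ ⊎ l ≡ i ⊎ l ≡ k) → D ─ P k ⊆ P i₀ ∪ P i
  D─P⊆P₀∪P {i} {k} only x∈D─Pk with x∈p─q⁻ D (P k) x∈D─Pk
  ... | x∈D , x∉Pk with ∈D⇒∈P x∈D
  ... | l , x∈Pl with only l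
  ... | inj₁ refl        = p⊆p∪q (P i) x∈Pl
  ... | inj₂ (inj₁ refl) = q⊆p∪q (P i₀) (P i) x∈Pl
  ... | inj₂ (inj₂ refl) = contradiction x∈Pl x∉Pk

  2≤∣P∣ : ∀ {i} → i ≢ i₀ → 2 ≤ ∣ P i ∣
  2≤∣P∣ {i} i≢i₀ =
    let k , _ , _ , only = fin3-third i₀ i (≢-sym i≢i₀) in
    ≤-pred (begin
      3                   ≤⟨ simple⇒3≤∣circuit∣ M simple (D─P-circuit k) ⟩
      ∣ D ─ P k ∣         ≤⟨ p⊆q⇒∣p∣≤∣q∣ (D─P⊆P₀∪P only) ⟩
      ∣ P i₀ ∪ P i ∣      ≤⟨ ∣p∪q∣≤∣p∣+∣q∣ (P i₀) (P i) ⟩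
      ∣ P i₀ ∣ + ∣ P i ∣  ≤⟨ +-monoˡ-≤ ∣ P i ∣ (≤-trans (p⊆q⇒∣p∣≤∣q∣ P₀⊆⁅f⁆) (≤-reflexive (∣⁅x⁆∣≡1 f))) ⟩
      1 + ∣ P i ∣         ∎)
    where open ≤-Reasoning

  D─P-smaller : ∀ {i} → i ≢ i₀ → ∣ D ─ P i ∣ < ∣ C ∣
  D─P-smaller {i} i≢i₀ = +-cancelʳ-≤ 1 _ _ (begin
      suc ∣ D ─ P i ∣ + 1    ≡⟨ sym (+-suc _ 1) ⟩
      ∣ D ─ P i ∣ + 2        ≤⟨ +-monoʳ-≤ _ (2≤∣P∣ i≢i₀) ⟩
      ∣ D ─ P i ∣ + ∣ P i ∣  ≡⟨ ∣p─q∣+∣q∣≡∣p∣ D (P i) (∈P⇒∈D i) ⟩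
      ∣ D ∣                  ≤⟨ ∣p∪q∣≤∣p∣+∣q∣ C ⁅ f ⁆ ⟩
      ∣ C ∣ + ∣ ⁅ f ⁆ ∣      ≡⟨ cong (∣ C ∣ +_) (∣⁅x⁆∣≡1 f) ⟩
      ∣ C ∣ + 1              ∎)
    where open ≤-Reasoning

  ∈D─P─X⁻ : ∀ {X e i} → C ─ X ≡ ⁅ e ⁆ → x ∈ D ─ P i ─ X → (x ≡ e ⊎ x ≡ f) × x ∉ P i × x ∉ X
  ∈D─P─X⁻ {x = x} {X} {e} {i} C─X≡⁅e⁆ x∈D─Pi─X =
    let x∈D─Pi , x∉X = x∈p─q⁻ (D ─ P i) X x∈D─Pi─X
        x∈D , x∉Pi = x∈p─q⁻ D (P i) x∈D─Pi
        x∈C─X : x ∈ C → x ∈ ⁅ e ⁆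
        x∈C─X x∈C = subst (x ∈_) C─X≡⁅e⁆ (x∈p∧x∉q⇒x∈p─q x∈C x∉X)
    in [ inj₁ ∘ x∈⁅y⁆⇒x≡y e ∘ x∈C─X , inj₂ ∘ x∈⁅y⁆⇒x≡y f ] (x∈p∪q⁻ C ⁅ f ⁆ x∈D) , x∉Pi , x∉X

  ∈D─P─X⁺ : ∀ {X i} → x ∈ D → x ∉ P i → x ∉ X → x ∈ D ─ P i ─ X
  ∈D─P─X⁺ x∈D x∉Pi x∉X = x∈p∧x∉q⇒x∈p─q (x∈p∧x∉q⇒x∈p─q x∈D x∉Pi) x∉X

  module _ {X e} (C─X≡⁅e⁆ : C ─ X ≡ ⁅ e ⁆) where

    e∈C─X : e ∈ C ─ X
    e∈C─X = subst (e ∈_) (sym C─X≡⁅e⁆) (x∈⁅x⁆ e)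

    e∈C : e ∈ C
    e∈C = proj₁ (x∈p─q⁻ C X e∈C─X)

    e∉X : e ∉ X
    e∉X = proj₂ (x∈p─q⁻ C X e∈C─X)

    e-block : ∃[ b ] e ∈ P b
    e-block = ∈D⇒∈P (p⊆p∪q ⁅ f ⁆ e∈C)

    b : Fin 3
    b = proj₁ e-block

    b≢i₀ : b ≢ i₀
    b≢i₀ b≡i₀ = ∈C⇒∉P₀ e∈C (subst (λ i → e ∈ P i) b≡i₀ (proj₂ e-block))

    -- If f ∈ X, remove the block avoiding e and f, so e stays the only element
    -- outside X; otherwise remove the block of e, leaving f as the only one.
    one-outside : ∃[ i ] (i ≢ i₀ × ∃[ e′ ] D ─ P i ─ X ≡ ⁅ e′ ⁆)
    one-outside with f ∈? X
    ... | yes f∈X =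
      let k , k≢i₀ , k≢b , _ = fin3-third i₀ b (≢-sym b≢i₀)
          e∈D─Pk─X = ∈D─P─X⁺ (p⊆p∪q ⁅ f ⁆ e∈C) (∈P⇒∉P (≢-sym k≢b) (proj₂ e-block)) e∉X
      in k , k≢i₀ , e , x∈p∧p⊆⁅x⁆⇒p≡⁅x⁆ e∈D─Pk─X (only-e ∘ ∈D─P─X⁻ C─X≡⁅e⁆)
      where
      only-e : ∀ {y k} → (y ≡ e ⊎ y ≡ f) × y ∉ P k × y ∉ X → y ∈ ⁅ e ⁆
      only-e (inj₁ refl , _)         = x∈⁅x⁆ e
      only-e (inj₂ refl , _ , y∉X)   = contradiction f∈X y∉X
    ... | no f∉X =
      let f∈D─Pb─X = ∈D─P─X⁺ (q⊆p∪q C ⁅ f ⁆ (x∈⁅x⁆ f)) (∈P⇒∉P (≢-sym b≢i₀) f∈P₀) f∉X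
      in b , b≢i₀ , f , x∈p∧p⊆⁅x⁆⇒p≡⁅x⁆ f∈D─Pb─X (only-f ∘ ∈D─P─X⁻ C─X≡⁅e⁆)
      where
      only-f : ∀ {y} → (y ≡ e ⊎ y ≡ f) × y ∉ P b × y ∉ X → y ∈ ⁅ f ⁆
      only-f (inj₁ refl , y∉Pb , _)  = contradiction (proj₂ e-block) y∉Pb
      only-f (inj₂ refl , _)         = x∈⁅x⁆ f

  smaller-circuit : ∀ {X e} → C ─ X ≡ ⁅ e ⁆ →
                    ∃[ C′ ] (IsCircuit M C′ × ∣ C′ ∣ < ∣ C ∣ × ∃[ e′ ] C′ ─ X ≡ ⁅ e′ ⁆)
  smaller-circuit C─X≡⁅e⁆ =
    let i , i≢i₀ , e′ , D─Pi─X≡⁅e′⁆ = one-outside C─X≡⁅e⁆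
    in D ─ P i , D─P-circuit i , D─P-smaller i≢i₀ , e′ , D─Pi─X≡⁅e′⁆

module _ (M : Matroid n) (simple : Simple M)
  (degree-three : ∀ C → IsCircuit M C →
    cl M C ≡ C ⊎ ∃[ f ] (f ∈ cl M C × IsDoubleCircuitOfDegree M 3 (C ∪ ⁅ f ⁆))) where

  closed-circuit-one-outside : ∀ {X C e} → IsCircuit M C → C ─ X ≡ ⁅ e ⁆ →
                               ∃[ C′ ] (closedCircuits M C′ × ∣ C′ ─ X ∣ ≡ 1)
  closed-circuit-one-outside {X} = go (∣∣-<-wellFounded _)
    where
    go : ∀ {C e} → Acc (_<_ on ∣_∣) C → IsCircuit M C → C ─ X ≡ ⁅ e ⁆ →
         ∃[ C′ ] (closedCircuits M C′ × ∣ C′ ─ X ∣ ≡ 1)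
    go {C} {e} (acc smaller) C-circuit C─X≡⁅e⁆ with degree-three C C-circuit
    ... | inj₁ clC≡C = C , (C-circuit , clC≡C) , trans (cong ∣_∣ C─X≡⁅e⁆) (∣⁅x⁆∣≡1 e)
    ... | inj₂ (_ , _ , _ , _ , partition) =
      let C′ , C′-circuit , ∣C′∣<∣C∣ , _ , C′─X≡⁅e′⁆ =
            DegreeThree.smaller-circuit M simple C-circuit partition C─X≡⁅e⁆
      in go (smaller ∣C′∣<∣C∣) C′-circuit C′─X≡⁅e′⁆

  closedCircuits-tropical : IsTropicalBasis M (closedCircuits M)
  closedCircuits-tropical = (λ _ → proj₁) , λ X X≢clX →
    let e , e∈clX , e∉X = ≢cl⇒∃∈cl∖ M X≢clX
        C , C-circuit , C─X≡⁅e⁆ = fundamental-circuit M e∈clX e∉X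
    in closed-circuit-one-outside C-circuit C─X≡⁅e⁆

theorem2 : (n : ℕ) (M : Matroid n) → Simple M
    → (∀ C → IsCircuit M C
    → (cl M C ≡ C) ⊎ (∃[ f ] (f ∈ cl M C × IsDoubleCircuitOfDegree M 3 (C ∪ ⁅ f ⁆))))
    → IsUniqueMinimalTropicalBasis M (closedCircuits M)
theorem2 n M simple degree-three =
  least⇒unique-minimal-tropical-basis M (closedCircuits-tropical M simple degree-three)
    (closed-circuit∈tropical-basis M)
    (λ C C-circuit → map′ (C-circuit ,_) proj₂ (≡-dec Bool._≟_ (cl M C) C))
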